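{- If $n\ge3$ is odd, $p\ge0$ and $1\le k\le n$, then $$S(C_n\cup pK_1,k)=\sum_{i=0}^{(n-3)/2}S(Q_{2i+3}\cup pK_1,k).$$
   Context: All graphs are finite, simple and undirected. Two colorings (assignments of colors to vertices with adjacent vertices colored differently) are equivalent if they induce the same partition of the vertex set into color classes; $S(G,k)$ denotes the number of non-equivalent colorings of $G$ using exactly $k$ colors. $C_n$ is the cycle on $n$ vertices. For $m\ge3$, $Q_m$ is the graph obtained from the path $P_m$ on $m$ vertices by adding an edge between an end vertex $v$ of the path and the vertex at distance $2$ from $v$ on the path. $pK_1$ denotes $p$ isolated vertices and $\cup$ disjoint union. -}

module Defs where

open import Data.Nat using (ℕ; zero; suc; _+_; _≡ᵇ_; _<ᵇ_; _/_)
open import Data.Nat.Properties using (_!≢0)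
open import Data.Nat using (_!)
open import Data.Bool using (Bool; true; false; _∧_; _∨_; not; if_then_else_)
open import Data.Fin using (Fin; toℕ; splitAt; _≟_)
open import Data.Sum using (inj₁; inj₂)
open import Data.List using (List; []; _∷_; map; concatMap; allFin)
open import Data.Bool.ListAction using (all; any)
open import Relation.Nullary.Decidable using (⌊_⌋)
open import Relation.Nullary using (does)

-- A finite simple graph on vertex set Fin V, given by a Boolean adjacency
-- relation.  (All graphs constructed below are symmetric and irreflexive.)
record Graph : Set where
  field
    V   : ℕ
    adj : Fin V → Fin V → Bool
open Graph public

_∪K₁_ : Graph → ℕ → Graph
G ∪K₁ p = record { V = V G + p ; adj = a }
  where
  a : Fin (V G + p) → Fin (V G + p) → Bool
  a i j with splitAt (V G) i | splitAt (V G) j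
  ... | inj₁ i' | inj₁ j' = adj G i' j'
  ... | _       | _       = false

consec : ℕ → ℕ → Bool
consec a b = (b ≡ᵇ suc a) ∨ (a ≡ᵇ suc b)

pairIs : ℕ → ℕ → ℕ → ℕ → Bool
pairIs a b x y = ((a ≡ᵇ x) ∧ (b ≡ᵇ y)) ∨ ((a ≡ᵇ y) ∧ (b ≡ᵇ x))

C : ℕ → Graph
C n = record { V = n ; adj = λ i j → consec (toℕ i) (toℕ j) ∨ pairIs (toℕ i) (toℕ j) 0 (pred n) }
  where
  pred : ℕ → ℕ
  pred zero = zero
  pred (suc m) = m

Q : ℕ → Graph
Q m = record { V = m ; adj = λ i j → consec (toℕ i) (toℕ j) ∨ pairIs (toℕ i) (toℕ j) 0 2 }

allMaps : (n k : ℕ) → List (Fin n → Fin k)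
allMaps zero    k = (λ ()) ∷ []
allMaps (suc n) k = concatMap (λ c → map (λ f → ext c f) (allMaps n k)) (allFin k)
  where
  ext : Fin k → (Fin n → Fin k) → Fin (suc n) → Fin k
  ext c f Fin.zero    = c
  ext c f (Fin.suc i) = f i

proper : (G : Graph) {k : ℕ} → (Fin (V G) → Fin k) → Bool
proper G c = all (λ i → all (λ j → not (adj G i j) ∨ not (does (c i ≟ c j))) (allFin (V G))) (allFin (V G))

onto : {n k : ℕ} → (Fin n → Fin k) → Bool
onto {n} {k} c = all (λ x → any (λ i → does (c i ≟ x)) (allFin n)) (allFin k)

count : {A : Set} → (A → Bool) → List A → ℕ
count b [] = 0
count b (x ∷ xs) = if b x then suc (count b xs) else count b xs

P-exact : Graph → ℕ → ℕ
P-exact G k = count (λ c → proper G c ∧ onto c) (allMaps (V G) k)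

-- S(G,k): number of non-equivalent colourings using exactly k colours,
-- i.e. partitions of V(G) into exactly k nonempty independent sets.
-- Each such partition corresponds to exactly k! surjective proper colourings
-- (one per labelling of the classes by the colours), hence the division.
S : Graph → ℕ → ℕ
S G k = (P-exact G k / (k !)) {{k !≢0}}

-- S G k is P G k / k!, where P G k counts the proper colourings of G that use
-- all k colours.  Both C (t + 1) and Q (t + 1 + m) (where t = 2) are a path with
-- the chord {0, t}: a cycle of length t + 1 with a tail of m further vertices.
-- Colouring the vertices in order, the number of ways to finish depends only on
-- the number u of colours used so far and on whether the current colour is that
-- of vertex 0; this gives recurrences in u, from which
--   P (C (n + 3)) = P (C (n + 1)) + P (Q (n + 3))
-- (for chromatic polynomials: (x-1)^(n+3) - (x-1)^(n+1) = x (x-1) (x-2) (x-1)^n).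
-- Summing over odd n gives the theorem for P.  A count from a state with u
-- colours used is divisible by (k - u)!, so k! divides each P (Q m) and the
-- division by k! distributes over the sum.
module Submission where

open import Defs
open import Data.Nat using (ℕ; _+_; _*_; _∸_; _/_; _%_; _≤_)
open import Data.List using (map; upTo)
open import Data.Nat.ListAction using (sum)
open import Relation.Binary.PropositionalEquality using (_≡_)

open import Algebra.Properties.CommutativeSemigroup using (x∙yz≈y∙xz)
open import Data.Bool using (Bool; true; false; T; _∧_; _∨_; not; if_then_else_)
open import Data.Bool.ListAction using (and; or; all; any)
open import Data.Bool.Properties
  using (T-∧; T-∨; ∧-assoc; ∧-comm; ∨-assoc; ∨-zeroʳ; ∨-identityʳ; if-float; if-cong-else)
open import Data.Empty using (⊥-elim)
open import Data.Fin using (Fin; zero; suc; toℕ; fromℕ; _↑ˡ_; splitAt; punchIn; punchOut; _≟_)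
open import Data.Fin.Properties
  using (toℕ-↑ˡ; toℕ-fromℕ; toℕ-injective; splitAt-↑ˡ; splitAt⁻¹-↑ˡ; punchInᵢ≢i; punchIn-injective; punchIn-punchOut)
open import Data.List using (List; []; _∷_; _++_; concatMap; tabulate; allFin)
open import Data.List.Membership.Propositional.Properties using (∈-allFin)
open import Data.List.Properties using (map-tabulate; map-cong; map-++; upTo-∷ʳ)
import Data.List.Relation.Unary.All as All
open import Data.List.Relation.Unary.All.Properties using (all⁺; all⁻; tabulate⁺)
import Data.Nat as ℕ
open import Data.Nat using (zero; suc; pred; s≤s; z≤n; _≡ᵇ_; _!; NonZero)
open import Data.Nat.Divisibility using (_∣_; _∣0; ∣-refl; ∣m∣n⇒∣m+n; ∣n⇒∣m*n; *-monoʳ-∣)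
open import Data.Nat.DivMod using (+-distrib-/-∣ˡ; m*n/n≡m; 0/n≡0)
open import Data.Nat.ListAction.Properties using (sum-++)
open import Data.Nat.Properties
  using ( +-0-commutativeMonoid; +-commutativeSemigroup; +-assoc; +-comm; +-identityʳ; *-comm; *-zeroʳ
        ; *-distribˡ-+; +-∸-assoc; m+n∸n≡m; pred[m∸n]≡m∸[1+n]; m≤n⇒m≤1+n; <⇒≢; ≡ᵇ⇒≡; ≡⇒≡ᵇ
        ; suc-injective; _!≢0 )
open import Algebra.Properties.CommutativeMonoid.Sum +-0-commutativeMonoid
  using (sum-syntax; sum-cong-≗; sum-remove)
open import Data.Nat.Tactic.RingSolver using (solve-∀)
open import Data.Product as Product using (_×_; _,_; proj₁; proj₂; ∃-syntax)
open import Data.Product.Function.NonDependent.Propositional using (_×-⇔_)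
open import Data.Sum as Sum using (_⊎_; inj₁; inj₂)
open import Function using (_∘_; id)
open import Function.Bundles using (_⇔_; mk⇔; Equivalence)
open import Function.Properties.Equivalence using (⇔-setoid) renaming (refl to ⇔-refl; sym to ⇔-sym)
open import Level using (0ℓ)
open import Relation.Binary.PropositionalEquality
  using (refl; sym; trans; cong; cong₂; subst; subst₂; _≢_; module ≡-Reasoning)
import Relation.Binary.Reasoning.Setoid as SetoidReasoning
open import Relation.Nullary using (does; yes; no)
open import Relation.Nullary.Decidable using (dec-true; dec-false)

module ⇔-Reasoning = SetoidReasoning (⇔-setoid 0ℓ)

_==_ : ∀ {n} → Fin n → Fin n → Bool
a == b = does (a ≟ b)

==-refl : ∀ {n} (a : Fin n) → (a == a) ≡ true
==-refl a = dec-true (a ≟ a) refl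

punchIn-== : ∀ {n} (a : Fin (suc n)) x y → (punchIn a x == punchIn a y) ≡ (x == y)
punchIn-== a x y with x ≟ y
... | yes refl = ==-refl (punchIn a x)
... | no  x≢y  = dec-false (punchIn a x ≟ punchIn a y) (x≢y ∘ punchIn-injective a x y)

T-not-== : ∀ {n} (a b : Fin n) → T (not (a == b)) ⇔ a ≢ b
T-not-== a b with a ≟ b
... | yes a≡b = mk⇔ (λ ()) (λ a≢b → a≢b a≡b)
... | no  a≢b = mk⇔ (λ _ → a≢b) _

T-⇒ : ∀ {x y} → T (not x ∨ y) ⇔ (T x → T y)
T-⇒ {false} = mk⇔ (λ _ ()) _
T-⇒ {true}  = mk⇔ (λ y _ → y) (λ f → f _)

T⇔T⇒≡ : ∀ {x y} → T x ⇔ T y → x ≡ y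
T⇔T⇒≡ {false} {false} _   = refl
T⇔T⇒≡ {false} {true}  x⇔y = ⊥-elim (Equivalence.from x⇔y _)
T⇔T⇒≡ {true}  {false} x⇔y = ⊥-elim (Equivalence.to x⇔y _)
T⇔T⇒≡ {true}  {true}  _   = refl

-- Sums over the colours

size : ∀ {n} → (Fin n → Bool) → ℕ
size {n} U = ∑[ c < n ] (if U c then 1 else 0)

size≤ : ∀ {n} (U : Fin n → Bool) → size U ≤ n
size≤ {zero}  U = z≤n
size≤ {suc n} U with U zero
... | true  = s≤s (size≤ (U ∘ suc))
... | false = m≤n⇒m≤1+n (size≤ (U ∘ suc))

size-punchIn : ∀ {n} (U : Fin (suc n) → Bool) a → U a ≡ true → size U ≡ suc (size (U ∘ punchIn a))
size-punchIn U a Ua = trans (sum-remove {i = a} (λ c → if U c then 1 else 0))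
  (cong (λ b → (if b then 1 else 0) + size (U ∘ punchIn a)) Ua)

∑-const : ∀ {n} X → ∑[ c < n ] X ≡ n * X
∑-const {zero}  X = refl
∑-const {suc n} X = cong (X +_) (∑-const {n} X)

∑-if : ∀ {n} (U : Fin n → Bool) X Y → ∑[ c < n ] (if U c then X else Y) ≡ size U * X + (n ∸ size U) * Y
∑-if {zero}  U X Y = refl
∑-if {suc n} U X Y with U zero | ∑-if (U ∘ suc) X Y | size≤ (U ∘ suc)
... | true  | ih | _   = trans (cong (X +_) ih) (sym (+-assoc X _ _))
... | false | ih | s≤n = begin
  Y + ∑[ c < n ] (if U (suc c) then X else Y) ≡⟨ cong (Y +_) ih ⟩
  Y + (s * X + (n ∸ s) * Y)                  ≡⟨ x∙yz≈y∙xz +-commutativeSemigroup Y (s * X) _ ⟩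
  s * X + (1 + (n ∸ s)) * Y                  ≡⟨ cong (λ j → s * X + j * Y) (+-∸-assoc 1 s≤n) ⟨
  s * X + (suc n ∸ s) * Y                    ∎
  where
  open ≡-Reasoning
  s = size (U ∘ suc)

∑-if-== : ∀ {n} (a : Fin (suc n)) Z (g : Fin (suc n) → ℕ) →
          ∑[ c < suc n ] (if c == a then Z else g c) ≡ Z + ∑[ c < n ] g (punchIn a c)
∑-if-== a Z g = trans (sum-remove {i = a} (λ c → if c == a then Z else g c)) (cong₂ _+_
  (cong (λ b → if b then Z else g a) (==-refl a))
  (sum-cong-≗ λ c → cong (λ b → if b then Z else g (punchIn a c)) (dec-false (punchIn a c ≟ a) (punchInᵢ≢i a c))))

∑-if-avoiding : ∀ {n} (U : Fin n → Bool) {a} → U a ≡ true → ∀ X Y →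
                ∑[ c < n ] (if c == a then 0 else (if U c then X else Y)) ≡ (size U ∸ 1) * X + (n ∸ size U) * Y
∑-if-avoiding {suc n} U {a} Ua X Y rewrite size-punchIn U a Ua =
  trans (∑-if-== a 0 (λ c → if U c then X else Y)) (∑-if (U ∘ punchIn a) X Y)

∑-if-avoiding-marked :
  ∀ {n} (U : Fin n → Bool) {a b} → a ≢ b → U a ≡ true → U b ≡ true → ∀ X Y Z →
  ∑[ c < n ] (if c == a then 0 else (if c == b then Z else (if U c then X else Y)))
    ≡ Z + ((size U ∸ 2) * X + (n ∸ size U) * Y)
∑-if-avoiding-marked {suc zero}    U {zero} {zero} a≢b = ⊥-elim (a≢b refl)
∑-if-avoiding-marked {suc (suc n)} U {a} {b} a≢b Ua Ub X Y Z = begin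
  ∑[ c < 2 + n ] (if c == a then 0 else g c)              ≡⟨ ∑-if-== a 0 g ⟩
  ∑[ c < 1 + n ] g (punchIn a c)                          ≡⟨ sum-cong-≗ (λ c → cong (λ β → if β then Z else φ (punchIn a c)) (is-b c)) ⟩
  ∑[ c < 1 + n ] (if c == b′ then Z else φ (punchIn a c))  ≡⟨ ∑-if-== b′ Z (φ ∘ punchIn a) ⟩
  Z + ∑[ c < n ] φ (punchIn a (punchIn b′ c))             ≡⟨ cong (Z +_) (∑-if U″ X Y) ⟩
  Z + (size U″ * X + (n ∸ size U″) * Y)                   ≡⟨ cong (λ s → Z + ((s ∸ 2) * X + (2 + n ∸ s) * Y)) size-U ⟨
  Z + ((size U ∸ 2) * X + (2 + n ∸ size U) * Y)           ∎
  where
  open ≡-Reasoning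
  φ g : Fin (2 + n) → ℕ
  φ c = if U c then X else Y
  g c = if c == b then Z else φ c
  b′ = punchOut a≢b
  b≡ : punchIn a b′ ≡ b
  b≡ = punchIn-punchOut a≢b
  U″ = U ∘ punchIn a ∘ punchIn b′
  size-U : size U ≡ 2 + size U″
  size-U = trans (size-punchIn U a Ua) (cong suc (size-punchIn (U ∘ punchIn a) b′ (trans (cong U b≡) Ub)))
  is-b : ∀ c → (punchIn a c == b) ≡ (c == b′)
  is-b c = trans (cong (punchIn a c ==_) (sym b≡)) (punchIn-== a c b′)

∅ : ∀ {n} → Fin n → Bool
∅ _ = false

insert : ∀ {n} → Fin n → (Fin n → Bool) → (Fin n → Bool)
insert c U x = U x ∨ (c == x)

insert-self : ∀ {n} (c : Fin n) U → insert c U c ≡ true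
insert-self c U = trans (cong (U c ∨_) (==-refl c)) (∨-zeroʳ (U c))

size-insert : ∀ {n} (U : Fin n → Bool) c → size (insert c U) ≡ (if U c then size U else suc (size U))
size-insert {suc n} U c = begin
  size (insert c U)                             ≡⟨ size-punchIn (insert c U) c (insert-self c U) ⟩
  suc (size (insert c U ∘ punchIn c))           ≡⟨ cong suc (sum-cong-≗ λ x → cong (λ b → if b then 1 else 0) (unchanged x)) ⟩
  suc rest                                      ≡⟨ split (U c) ⟩
  (if U c then here + rest else suc (here + rest)) ≡⟨ cong (λ s → if U c then s else suc s) (sum-remove {i = c} (λ x → if U x then 1 else 0)) ⟨
  (if U c then size U else suc (size U))        ∎
  where
  open ≡-Reasoning
  rest = size (U ∘ punchIn c)
  here = if U c then 1 else 0
  unchanged : ∀ x → insert c U (punchIn c x) ≡ U (punchIn c x)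
  unchanged x = trans (cong (U (punchIn c x) ∨_) (dec-false (c ≟ punchIn c x) (punchInᵢ≢i c x ∘ sym))) (∨-identityʳ _)
  split : ∀ b → suc rest ≡ (if b then (if b then 1 else 0) + rest else suc ((if b then 1 else 0) + rest))
  split true  = refl
  split false = refl

size-singleton : ∀ {n} (c : Fin n) → size (insert c ∅) ≡ 1
size-singleton {n} c = trans (size-insert ∅ c) (cong suc (trans (∑-const {n} 0) (*-zeroʳ n)))

∑-insert : ∀ {n} (U : Fin n → Bool) (F : ℕ → ℕ) →
           ∑[ c < n ] F (size (insert c U)) ≡ size U * F (size U) + (n ∸ size U) * F (suc (size U))
∑-insert U F = trans (sum-cong-≗ λ c → trans (cong F (size-insert U c)) (if-float F (U c))) (∑-if U _ _)

∑-insert-avoiding : ∀ {n} (U : Fin n → Bool) {a} → U a ≡ true → (F : ℕ → ℕ) →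
                    ∑[ c < n ] (if c == a then 0 else F (size (insert c U)))
                      ≡ (size U ∸ 1) * F (size U) + (n ∸ size U) * F (suc (size U))
∑-insert-avoiding U {a} Ua F = trans
  (sum-cong-≗ λ c → if-cong-else (c == a) (trans (cong F (size-insert U c)) (if-float F (U c))))
  (∑-if-avoiding U Ua _ _)

∑-insert-avoiding-marked :
  ∀ {n} (U : Fin n → Bool) {a b} → U a ≡ true → U b ≡ true → (H A : ℕ → ℕ) →
  ∑[ c < n ] (if c == a then 0 else (if c == b then H (size (insert c U)) else A (size (insert c U))))
    ≡ (if a == b then (size U ∸ 1) * A (size U) + (n ∸ size U) * A (suc (size U))
                 else H (size U) + ((size U ∸ 2) * A (size U) + (n ∸ size U) * A (suc (size U))))
∑-insert-avoiding-marked U {a} {b} Ua Ub H A with a ≟ b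
... | yes refl = trans (sum-cong-≗ λ c → unmarked (c == a)) (∑-insert-avoiding U Ua A)
  where
  unmarked : ∀ β {x y z : ℕ} → (if β then x else (if β then y else z)) ≡ (if β then x else z)
  unmarked true  = refl
  unmarked false = refl
... | no a≢b = trans (sum-cong-≗ λ c → if-cong-else (c == a) (marked c)) (∑-if-avoiding-marked U a≢b Ua Ub _ _ _)
  where
  marked : ∀ c → (if c == b then H (size (insert c U)) else A (size (insert c U)))
                   ≡ (if c == b then H (size U) else (if U c then A (size U) else A (suc (size U))))
  marked c with c ≟ b
  ... | yes refl = cong H (trans (size-insert U c) (cong (λ β → if β then size U else suc (size U)) Ub))
  ... | no  _    = trans (cong A (size-insert U c)) (if-float A (U c))

-- Counting colourings

count-++ : ∀ {A : Set} (b : A → Bool) xs ys → count b (xs ++ ys) ≡ count b xs + count b ys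
count-++ b []       ys = refl
count-++ b (x ∷ xs) ys with b x
... | true  = cong suc (count-++ b xs ys)
... | false = count-++ b xs ys

count-map : ∀ {A B : Set} (b : B → Bool) (g : A → B) xs → count b (map g xs) ≡ count (b ∘ g) xs
count-map b g []       = refl
count-map b g (x ∷ xs) with b (g x)
... | true  = cong suc (count-map b g xs)
... | false = count-map b g xs

count-concatMap : ∀ {A B : Set} (b : B → Bool) (h : A → List B) xs →
                  count b (concatMap h xs) ≡ sum (map (count b ∘ h) xs)
count-concatMap b h []       = refl
count-concatMap b h (x ∷ xs) =
  trans (count-++ b (h x) (concatMap h xs)) (cong (count b (h x) +_) (count-concatMap b h xs))

count-false : ∀ {A : Set} (xs : List A) → count (λ _ → false) xs ≡ 0
count-false []       = refl
count-false (x ∷ xs) = count-false xs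

count-cong : ∀ {A : Set} {b b′ : A → Bool} → (∀ x → b x ≡ b′ x) → ∀ xs → count b xs ≡ count b′ xs
count-cong eq []       = refl
count-cong {b = b} {b′} eq (x ∷ xs) rewrite eq x with b′ x
... | true  = cong suc (count-cong eq xs)
... | false = count-cong eq xs

sum-allFin : ∀ {n} (g : Fin n → ℕ) → sum (map g (allFin n)) ≡ ∑[ c < n ] g c
sum-allFin g = trans (cong sum (map-tabulate id g)) (sum-tabulate g)
  where
  sum-tabulate : ∀ {n} (g : Fin n → ℕ) → sum (tabulate g) ≡ ∑[ c < n ] g c
  sum-tabulate {zero}  g = refl
  sum-tabulate {suc n} g = cong (g zero +_) (sum-tabulate (g ∘ suc))

countMaps : ∀ {k} N → ((Fin N → Fin k) → Bool) → ℕ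
countMaps {k} N b = count b (allMaps N k)

countMaps-suc : ∀ {k} N (B : Fin k → (Fin N → Fin k) → Bool) →
                countMaps (suc N) (λ f → B (f zero) (f ∘ suc)) ≡ ∑[ c < k ] countMaps N (B c)
countMaps-suc {k} N B = trans (count-concatMap _ _ (allFin k)) (trans
  (cong sum (map-cong (λ c → count-map _ _ (allMaps N k)) (allFin k)))
  (sum-allFin (λ c → countMaps N (B c))))

countMaps-guard : ∀ {k} N b (R : (Fin N → Fin k) → Bool) →
                  countMaps N (λ f → not b ∧ R f) ≡ (if b then 0 else countMaps N R)
countMaps-guard {k} N true  R = count-false (allMaps N k)
countMaps-guard     N false R = refl

countMaps-cong : ∀ {k} N {b b′ : (Fin N → Fin k) → Bool} → (∀ f → b f ≡ b′ f) → countMaps N b ≡ countMaps N b′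
countMaps-cong {k} N eq = count-cong eq (allMaps N k)

sum-map-upTo-suc : ∀ (g : ℕ → ℕ) n → sum (map g (upTo (suc n))) ≡ sum (map g (upTo n)) + g n
sum-map-upTo-suc g n = begin
  sum (map g (upTo (suc n)))       ≡⟨ cong (sum ∘ map g) (upTo-∷ʳ n) ⟨
  sum (map g (upTo n ++ n ∷ []))   ≡⟨ cong sum (map-++ g (upTo n) (n ∷ [])) ⟩
  sum (map g (upTo n) ++ g n ∷ []) ≡⟨ sum-++ (map g (upTo n)) (g n ∷ []) ⟩
  sum (map g (upTo n)) + (g n + 0) ≡⟨ cong (sum (map g (upTo n)) +_) (+-identityʳ (g n)) ⟩
  sum (map g (upTo n)) + g n       ∎
  where open ≡-Reasoning

all-cong : ∀ {A : Set} {P Q : A → Bool} → (∀ x → P x ≡ Q x) → ∀ xs → all P xs ≡ all Q xs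
all-cong P≗Q xs = cong and (map-cong P≗Q xs)

T-all-allFin : ∀ {n} (P : Fin n → Bool) → T (all P (allFin n)) ⇔ (∀ i → T (P i))
T-all-allFin {n} P = mk⇔ (λ h i → All.lookup (all⁺ P (allFin n) h) (∈-allFin i)) (all⁻ P ∘ tabulate⁺)

all-allFin≡size : ∀ {n} (U : Fin n → Bool) → all U (allFin n) ≡ (size U ≡ᵇ n)
all-allFin≡size U = trans (cong and (map-tabulate id U)) (and-tabulate U)
  where
  and-tabulate : ∀ {n} (U : Fin n → Bool) → and (tabulate U) ≡ (size U ≡ᵇ n)
  and-tabulate {zero}  U = refl
  and-tabulate {suc n} U with U zero
  ... | true  = and-tabulate (U ∘ suc)
  ... | false = sym (dec-false (size (U ∘ suc) ℕ.≟ suc n) (<⇒≢ (s≤s (size≤ (U ∘ suc)))))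

any-allFin-suc : ∀ {n} (P : Fin (suc n) → Bool) → any P (allFin (suc n)) ≡ P zero ∨ any (P ∘ suc) (allFin n)
any-allFin-suc P = cong (P zero ∨_) (cong or (trans (map-tabulate suc P) (sym (map-tabulate id (P ∘ suc)))))

covers : ∀ {k} N → (Fin k → Bool) → (Fin N → Fin k) → Bool
covers {k} zero    U f = all U (allFin k)
covers     (suc N) U f = covers N (insert (f zero) U) (f ∘ suc)

covers≡all : ∀ {k} N (U : Fin k → Bool) f →
             covers N U f ≡ all (λ x → U x ∨ any (λ i → f i == x) (allFin N)) (allFin k)
covers≡all {k} zero    U f = all-cong (λ x → sym (∨-identityʳ (U x))) (allFin k)
covers≡all {k} (suc N) U f = trans (covers≡all N (insert (f zero) U) (f ∘ suc)) (all-cong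
  (λ x → trans (∨-assoc (U x) _ _) (cong (U x ∨_) (sym (any-allFin-suc (λ i → f i == x))))) (allFin k))

onto≡covers : ∀ {N k} (f : Fin N → Fin k) → onto f ≡ covers N ∅ f
onto≡covers {N} f = sym (covers≡all N ∅ f)

-- Proper and surjective colourings

Proper : (G : Graph) {k : ℕ} → (Fin (V G) → Fin k) → Set
Proper G f = ∀ i j → T (adj G i j) → f i ≢ f j

T-proper : ∀ G {k} (f : Fin (V G) → Fin k) → T (proper G f) ⇔ Proper G f
T-proper G f = mk⇔
  (λ h i j → to (T-not-== (f i) (f j)) ∘ to T-⇒ (to (T-all-allFin _) (to (T-all-allFin _) h i) j))
  (λ h → from (T-all-allFin _) λ i → from (T-all-allFin _) λ j → from T-⇒ (from (T-not-== (f i) (f j)) ∘ h i j))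
  where open Equivalence

Proper-∪K₁ : ∀ G p {k} (f : Fin (V G + p) → Fin k) → Proper (G ∪K₁ p) f ⇔ Proper G (λ i → f (i ↑ˡ p))
Proper-∪K₁ G p f = mk⇔ (λ h i j a → h (i ↑ˡ p) (j ↑ˡ p) (subst T (sym (adj-↑ˡ i j)) a)) from
  where
  adj-↑ˡ : ∀ i j → adj (G ∪K₁ p) (i ↑ˡ p) (j ↑ˡ p) ≡ adj G i j
  adj-↑ˡ i j rewrite splitAt-↑ˡ (V G) i p | splitAt-↑ˡ (V G) j p = refl
  from : Proper G (λ i → f (i ↑ˡ p)) → Proper (G ∪K₁ p) f
  from h i j a with splitAt (V G) i in i≡ | splitAt (V G) j in j≡
  ... | inj₁ i′ | inj₁ j′ = subst₂ (λ x y → f x ≢ f y) (splitAt⁻¹-↑ˡ i≡) (splitAt⁻¹-↑ˡ j≡) (h i′ j′ a)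
  ... | inj₁ _  | inj₂ _  = ⊥-elim a
  ... | inj₂ _  | _       = ⊥-elim a

-- C (suc n) is pathWithChord (suc n) n and Q m is pathWithChord m 2, definitionally.
pathWithChord : ℕ → ℕ → Graph
pathWithChord N t = record { V = N ; adj = λ i j → consec (toℕ i) (toℕ j) ∨ pairIs (toℕ i) (toℕ j) 0 t }

ProperOnPath : ∀ {N k} → (Fin N → Fin k) → Set
ProperOnPath g = ∀ i j → toℕ j ≡ suc (toℕ i) → g i ≢ g j

ProperOnChord : ∀ {N k} → ℕ → (Fin N → Fin k) → Set
ProperOnChord t g = ∀ i j → toℕ i ≡ 0 → toℕ j ≡ t → g i ≢ g j

T-consec : ∀ a b → T (consec a b) ⇔ (b ≡ suc a ⊎ a ≡ suc b)
T-consec a b = mk⇔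
  (Sum.map (≡ᵇ⇒≡ b (suc a)) (≡ᵇ⇒≡ a (suc b)) ∘ to T-∨)
  (from (T-∨ {b ≡ᵇ suc a}) ∘ Sum.map (≡⇒≡ᵇ b (suc a)) (≡⇒≡ᵇ a (suc b)))
  where open Equivalence

T-pairIs : ∀ a b x y → T (pairIs a b x y) ⇔ ((a ≡ x × b ≡ y) ⊎ (a ≡ y × b ≡ x))
T-pairIs a b x y = mk⇔
  (Sum.map (Product.map (≡ᵇ⇒≡ a x) (≡ᵇ⇒≡ b y) ∘ to T-∧) (Product.map (≡ᵇ⇒≡ a y) (≡ᵇ⇒≡ b x) ∘ to T-∧) ∘ to T-∨)
  (from (T-∨ {(a ≡ᵇ x) ∧ (b ≡ᵇ y)}) ∘
    Sum.map (from T-∧ ∘ Product.map (≡⇒≡ᵇ a x) (≡⇒≡ᵇ b y)) (from T-∧ ∘ Product.map (≡⇒≡ᵇ a y) (≡⇒≡ᵇ b x)))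
  where open Equivalence

Proper-pathWithChord : ∀ {N t k} (g : Fin N → Fin k) →
                       Proper (pathWithChord N t) g ⇔ (ProperOnPath g × ProperOnChord t g)
Proper-pathWithChord {t = t} g = mk⇔
  (λ h → (λ i j j≡ → h i j (from (T-∨ {consec (toℕ i) (toℕ j)}) (inj₁ (from (T-consec _ _) (inj₁ j≡)))))
       , (λ i j i≡ j≡ → h i j (from (T-∨ {consec (toℕ i) (toℕ j)}) (inj₂ (from (T-pairIs _ _ 0 t) (inj₁ (i≡ , j≡)))))))
  (Product.uncurry edge)
  where
  open Equivalence
  edge : ProperOnPath g → ProperOnChord t g → Proper (pathWithChord _ t) g
  edge onPath onChord i j a with to (T-∨ {consec (toℕ i) (toℕ j)}) a
  ... | inj₁ c with to (T-consec _ _) c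
  ...   | inj₁ j≡ = onPath i j j≡
  ...   | inj₂ i≡ = onPath j i i≡ ∘ sym
  edge onPath onChord i j a | inj₂ c with to (T-pairIs _ _ 0 t) c
  ...   | inj₁ (i≡ , j≡) = onChord i j i≡ j≡
  ...   | inj₂ (i≡ , j≡) = onChord j i j≡ i≡ ∘ sym

properOnPath : ∀ {k} n → (Fin (suc n) → Fin k) → Bool
properOnPath zero    g = true
properOnPath (suc n) g = not (g (suc zero) == g zero) ∧ properOnPath n (g ∘ suc)

T-properOnPath : ∀ {k} n (g : Fin (suc n) → Fin k) → T (properOnPath n g) ⇔ ProperOnPath g
T-properOnPath n g = mk⇔ (sound n g) (complete n g)
  where
  open Equivalence
  sound : ∀ n (g : Fin (suc n) → Fin _) → T (properOnPath n g) → ProperOnPath g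
  sound (suc n) g w zero    (suc zero)    _  = to (T-not-== _ _) (proj₁ (to T-∧ w)) ∘ sym
  sound (suc n) g w (suc i) (suc j)       j≡ = sound n (g ∘ suc) (proj₂ (to T-∧ w)) i j (suc-injective j≡)
  sound zero    g w zero    (suc ())      _
  sound (suc n) g w zero    (suc (suc j)) ()
  complete : ∀ n (g : Fin (suc n) → Fin _) → ProperOnPath g → T (properOnPath n g)
  complete zero    g _      = _
  complete (suc n) g onPath = from T-∧
    ( from (T-not-== _ _) (onPath zero (suc zero) refl ∘ sym)
    , complete n (g ∘ suc) (λ i j j≡ → onPath (suc i) (suc j) (cong suc j≡)))

ProperOnChord⇔ : ∀ {k} t m (g : Fin (suc (t + m)) → Fin k) → ProperOnChord t g ⇔ g (fromℕ t ↑ˡ m) ≢ g zero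
ProperOnChord⇔ t m g = mk⇔ (λ onChord → onChord zero end refl toℕ-end ∘ sym)
  (λ ≢g₀ i j i≡ j≡ → subst₂ (λ x y → g x ≢ g y)
    (toℕ-injective (sym i≡)) (toℕ-injective (trans toℕ-end (sym j≡))) (≢g₀ ∘ sym))
  where
  end = fromℕ t ↑ˡ m
  toℕ-end : toℕ end ≡ t
  toℕ-end = trans (toℕ-↑ˡ (fromℕ t) m) (toℕ-fromℕ t)

-- Divisibility by factorials

pred!∣⇒!∣* : ∀ n {X} → pred n ! ∣ X → n ! ∣ n * X
pred!∣⇒!∣* zero    _  = _ ∣0
pred!∣⇒!∣* (suc n) ∣X = *-monoʳ-∣ (suc n) ∣X

!∣-if-≡ᵇ : ∀ u n → (n ∸ u) ! ∣ (if u ≡ᵇ n then 1 else 0)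
!∣-if-≡ᵇ zero    zero    = ∣-refl
!∣-if-≡ᵇ zero    (suc n) = _ ∣0
!∣-if-≡ᵇ (suc u) zero    = _ ∣0
!∣-if-≡ᵇ (suc u) (suc n) = !∣-if-≡ᵇ u n

sum-map-/ : ∀ {d} .{{_ : NonZero d}} (g : ℕ → ℕ) xs → (∀ x → d ∣ g x) →
            sum (map g xs) / d ≡ sum (map (λ x → g x / d) xs)
sum-map-/ {d} g []       _   = 0/n≡0 d
sum-map-/     g (x ∷ xs) d∣g = trans (+-distrib-/-∣ˡ (sum (map g xs)) (d∣g x)) (cong (g x / _ +_) (sum-map-/ g xs d∣g))

-- Counting by the number of colours used

module _ (k : ℕ) where

  -- #covers q u: colourings of q further vertices which, with u colours
  -- already used, use all k colours.
  #covers : ℕ → ℕ → ℕ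
  #covers zero    u = if u ≡ᵇ k then 1 else 0
  #covers (suc q) u = u * #covers q u + (k ∸ u) * #covers q (suc u)

  count-covers : ∀ q (U : Fin k → Bool) → countMaps q (covers q U) ≡ #covers q (size U)
  count-covers zero    U = cong (λ b → if b then 1 else 0) (all-allFin≡size U)
  count-covers (suc q) U = begin
    countMaps (suc q) (covers (suc q) U)           ≡⟨ countMaps-suc q (λ c → covers q (insert c U)) ⟩
    ∑[ c < k ] countMaps q (covers q (insert c U)) ≡⟨ sum-cong-≗ (λ c → count-covers q (insert c U)) ⟩
    ∑[ c < k ] #covers q (size (insert c U))       ≡⟨ ∑-insert U (#covers q) ⟩
    #covers (suc q) (size U)                       ∎
    where open ≡-Reasoning

  !∣-step : ∀ u {X Y} → (k ∸ u) ! ∣ X → (k ∸ suc u) ! ∣ Y → (k ∸ u) ! ∣ X + (k ∸ u) * Y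
  !∣-step u {Y = Y} ∣X ∣Y =
    ∣m∣n⇒∣m+n ∣X (pred!∣⇒!∣* (k ∸ u) (subst (λ j → j ! ∣ Y) (sym (pred[m∸n]≡m∸[1+n] k u)) ∣Y))

  #covers-∣ : ∀ q u → (k ∸ u) ! ∣ #covers q u
  #covers-∣ zero    u = !∣-if-≡ᵇ u k
  #covers-∣ (suc q) u = !∣-step u (∣n⇒∣m*n u (#covers-∣ q u)) (#covers-∣ q (suc u))

module _ (k p : ℕ) where

  -- A partial colouring is summarised by the set U of colours used, the colour
  -- prev of the last vertex coloured and the colour c₀ of vertex 0.  pathFrom m
  -- and tadpoleFrom t m accept the colourings of the remaining vertices: t more
  -- on the cycle, m on the tail, then p isolated ones.  #paths m u and
  -- #home t m u / #away t m u count them when size U = u and prev is / is not c₀.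
  pathFrom : ∀ m → (Fin k → Bool) → Fin k → (Fin (m + p) → Fin k) → Bool
  pathFrom zero    U prev f = covers p U f
  pathFrom (suc m) U prev f = not (f zero == prev) ∧ pathFrom m (insert (f zero) U) (f zero) (f ∘ suc)

  tadpoleFrom : ∀ t m → (Fin k → Bool) → (c₀ prev : Fin k) → (Fin (t + m + p) → Fin k) → Bool
  tadpoleFrom zero    m U c₀ prev f = not (prev == c₀) ∧ pathFrom m U prev f
  tadpoleFrom (suc t) m U c₀ prev f = not (f zero == prev) ∧ tadpoleFrom t m (insert (f zero) U) c₀ (f zero) (f ∘ suc)

  #paths : ℕ → ℕ → ℕ
  #paths zero    u = #covers k p u
  #paths (suc m) u = (u ∸ 1) * #paths m u + (k ∸ u) * #paths m (suc u)

  #away #home : ℕ → ℕ → ℕ → ℕ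
  #away zero    m u = #paths m u
  #away (suc t) m u = #home t m u + ((u ∸ 2) * #away t m u + (k ∸ u) * #away t m (suc u))
  #home zero    m u = 0
  #home (suc t) m u = (u ∸ 1) * #away t m u + (k ∸ u) * #away t m (suc u)

  count-pathFrom : ∀ m U prev → U prev ≡ true → countMaps (m + p) (pathFrom m U prev) ≡ #paths m (size U)
  count-pathFrom zero    U prev _     = count-covers k p U
  count-pathFrom (suc m) U prev Uprev = begin
    countMaps (suc m + p) (pathFrom (suc m) U prev)
      ≡⟨ countMaps-suc (m + p) (λ c g → not (c == prev) ∧ pathFrom m (insert c U) c g) ⟩
    ∑[ c < k ] countMaps (m + p) (λ g → not (c == prev) ∧ pathFrom m (insert c U) c g)
      ≡⟨ sum-cong-≗ (λ c → trans (countMaps-guard (m + p) (c == prev) (pathFrom m (insert c U) c))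
           (if-cong-else (c == prev) (count-pathFrom m (insert c U) c (insert-self c U)))) ⟩
    ∑[ c < k ] (if c == prev then 0 else #paths m (size (insert c U)))
      ≡⟨ ∑-insert-avoiding U Uprev (#paths m) ⟩
    #paths (suc m) (size U)
      ∎
    where open ≡-Reasoning

  count-tadpoleFrom : ∀ t m U c₀ prev → U c₀ ≡ true → U prev ≡ true →
    countMaps (t + m + p) (tadpoleFrom t m U c₀ prev) ≡ (if prev == c₀ then #home t m (size U) else #away t m (size U))
  count-tadpoleFrom zero    m U c₀ prev _ Uprev = trans (countMaps-guard (m + p) (prev == c₀) (pathFrom m U prev))
    (if-cong-else (prev == c₀) (count-pathFrom m U prev Uprev))
  count-tadpoleFrom (suc t) m U c₀ prev Uc₀ Uprev = begin
    countMaps (suc t + m + p) (tadpoleFrom (suc t) m U c₀ prev)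
      ≡⟨ countMaps-suc (t + m + p) (λ c g → not (c == prev) ∧ tadpoleFrom t m (insert c U) c₀ c g) ⟩
    ∑[ c < k ] countMaps (t + m + p) (λ g → not (c == prev) ∧ tadpoleFrom t m (insert c U) c₀ c g)
      ≡⟨ sum-cong-≗ (λ c → trans (countMaps-guard (t + m + p) (c == prev) (tadpoleFrom t m (insert c U) c₀ c))
           (if-cong-else (c == prev) (count-tadpoleFrom t m (insert c U) c₀ c (cong (_∨ (c == c₀)) Uc₀) (insert-self c U)))) ⟩
    ∑[ c < k ] (if c == prev then 0 else
                 (if c == c₀ then #home t m (size (insert c U)) else #away t m (size (insert c U))))
      ≡⟨ ∑-insert-avoiding-marked U Uprev Uc₀ (#home t m) (#away t m) ⟩
    (if prev == c₀ then #home (suc t) m (size U) else #away (suc t) m (size U))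
      ∎
    where open ≡-Reasoning

  pathFrom-split : ∀ m U (F : Fin (suc m + p) → Fin k) →
    pathFrom m U (F zero) (F ∘ suc) ≡ properOnPath m (λ i → F (i ↑ˡ p)) ∧ covers (m + p) U (F ∘ suc)
  pathFrom-split zero    U F = refl
  pathFrom-split (suc m) U F = trans
    (cong (not (F (suc zero) == F zero) ∧_) (pathFrom-split m (insert (F (suc zero)) U) (F ∘ suc)))
    (sym (∧-assoc (not (F (suc zero) == F zero)) (properOnPath m (λ i → F (suc (i ↑ˡ p)))) _))

  tadpoleFrom-split : ∀ t m U c₀ (F : Fin (suc (t + m) + p) → Fin k) →
    tadpoleFrom t m U c₀ (F zero) (F ∘ suc)
      ≡ (properOnPath (t + m) (λ i → F (i ↑ˡ p)) ∧ not (F ((fromℕ t ↑ˡ m) ↑ˡ p) == c₀)) ∧ covers (t + m + p) U (F ∘ suc)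
  tadpoleFrom-split zero m U c₀ F = begin
    a ∧ pathFrom m U (F zero) (F ∘ suc) ≡⟨ cong (a ∧_) (pathFrom-split m U F) ⟩
    a ∧ (w ∧ cv)                        ≡⟨ ∧-assoc a w cv ⟨
    (a ∧ w) ∧ cv                        ≡⟨ cong (_∧ cv) (∧-comm a w) ⟩
    (w ∧ a) ∧ cv                        ∎
    where
    open ≡-Reasoning
    a  = not (F zero == c₀)
    w  = properOnPath m (λ i → F (i ↑ˡ p))
    cv = covers (m + p) U (F ∘ suc)
  tadpoleFrom-split (suc t) m U c₀ F = begin
    a ∧ tadpoleFrom t m (insert (F (suc zero)) U) c₀ (F (suc zero)) (λ i → F (suc (suc i)))
      ≡⟨ cong (a ∧_) (tadpoleFrom-split t m (insert (F (suc zero)) U) c₀ (F ∘ suc)) ⟩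
    a ∧ ((w ∧ e) ∧ cv) ≡⟨ cong (a ∧_) (∧-assoc w e cv) ⟩
    a ∧ (w ∧ (e ∧ cv)) ≡⟨ ∧-assoc a w (e ∧ cv) ⟨
    (a ∧ w) ∧ (e ∧ cv) ≡⟨ ∧-assoc (a ∧ w) e cv ⟨
    ((a ∧ w) ∧ e) ∧ cv ∎
    where
    open ≡-Reasoning
    a  = not (F (suc zero) == F zero)
    w  = properOnPath (t + m) (λ i → F (suc (i ↑ˡ p)))
    e  = not (F (suc ((fromℕ t ↑ˡ m) ↑ˡ p)) == c₀)
    cv = covers (t + m + p) (insert (F (suc zero)) U) (λ i → F (suc (suc i)))

  T-proper-tadpole : ∀ t m (F : Fin (suc (t + m) + p) → Fin k) →
    T (proper (pathWithChord (suc (t + m)) t ∪K₁ p) F)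
      ⇔ T (properOnPath (t + m) (λ i → F (i ↑ˡ p)) ∧ not (F ((fromℕ t ↑ˡ m) ↑ˡ p) == F zero))
  T-proper-tadpole t m F = begin
    T (proper (G ∪K₁ p) F)                               ≈⟨ T-proper (G ∪K₁ p) F ⟩
    Proper (G ∪K₁ p) F                                   ≈⟨ Proper-∪K₁ G p F ⟩
    Proper G g                                           ≈⟨ Proper-pathWithChord g ⟩
    (ProperOnPath g × ProperOnChord t g)                 ≈⟨ ⇔-sym (T-properOnPath (t + m) g) ×-⇔ ProperOnChord⇔ t m g ⟩
    (T (properOnPath (t + m) g) × g end ≢ g zero)        ≈⟨ ⇔-refl ×-⇔ T-not-== (g end) (g zero) ⟨
    (T (properOnPath (t + m) g) × T (not (g end == g zero))) ≈⟨ T-∧ ⟨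
    T (properOnPath (t + m) g ∧ not (g end == g zero))   ∎
    where
    open ⇔-Reasoning
    G = pathWithChord (suc (t + m)) t
    g : Fin (suc (t + m)) → Fin k
    g i = F (i ↑ˡ p)
    end = fromℕ t ↑ˡ m

  exact≡tadpoleFrom : ∀ t m (F : Fin (suc (t + m) + p) → Fin k) →
    (proper (pathWithChord (suc (t + m)) t ∪K₁ p) F ∧ onto F) ≡ tadpoleFrom t m (insert (F zero) ∅) (F zero) (F zero) (F ∘ suc)
  exact≡tadpoleFrom t m F = trans
    (cong₂ _∧_ (T⇔T⇒≡ (T-proper-tadpole t m F)) (onto≡covers F))
    (sym (tadpoleFrom-split t m (insert (F zero) ∅) (F zero) F))

  P-exact-tadpole : ∀ t m → P-exact (pathWithChord (suc (t + m)) t ∪K₁ p) k ≡ k * #home t m 1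
  P-exact-tadpole t m = begin
    P-exact (pathWithChord (suc (t + m)) t ∪K₁ p) k
      ≡⟨ countMaps-cong _ (exact≡tadpoleFrom t m) ⟩
    countMaps (suc (t + m + p)) (λ F → tadpoleFrom t m (insert (F zero) ∅) (F zero) (F zero) (F ∘ suc))
      ≡⟨ countMaps-suc (t + m + p) (λ c → tadpoleFrom t m (insert c ∅) c c) ⟩
    ∑[ c < k ] countMaps (t + m + p) (tadpoleFrom t m (insert c ∅) c c)
      ≡⟨ sum-cong-≗ first-colour ⟩
    ∑[ c < k ] #home t m 1
      ≡⟨ ∑-const {k} (#home t m 1) ⟩
    k * #home t m 1
      ∎
    where
    open ≡-Reasoning
    first-colour : ∀ c → countMaps (t + m + p) (tadpoleFrom t m (insert c ∅) c c) ≡ #home t m 1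
    first-colour c = begin
      countMaps (t + m + p) (tadpoleFrom t m (insert c ∅) c c)
        ≡⟨ count-tadpoleFrom t m (insert c ∅) c c (insert-self c ∅) (insert-self c ∅) ⟩
      (if c == c then #home t m (size (insert c ∅)) else #away t m (size (insert c ∅)))
        ≡⟨ cong (λ β → if β then #home t m (size (insert c ∅)) else #away t m (size (insert c ∅))) (==-refl c) ⟩
      #home t m (size (insert c ∅))
        ≡⟨ cong (#home t m) (size-singleton c) ⟩
      #home t m 1
        ∎

  P-exact-cycle : ∀ n → P-exact (C (suc n) ∪K₁ p) k ≡ k * #home n 0 1
  P-exact-cycle n = subst (λ N → P-exact (pathWithChord (suc N) n ∪K₁ p) k ≡ k * #home n 0 1)
    (+-identityʳ n) (P-exact-tadpole n 0)

  -- Fix a used colour c₀ ≠ prev and split by whether the path ends in c₀; as c₀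
  -- is already used, dropping that last vertex leaves exactly the paths one
  -- vertex shorter that do not end in c₀.
  #paths-split : ∀ m w → #paths (suc m) (2 + w) ≡ #away (suc m) 0 (2 + w) + #away m 0 (2 + w)
  #paths-split zero    w = algebra w _ _ (k ∸ (2 + w))
    where
    algebra : ∀ w a b K → suc w * a + K * b ≡ (w * a + K * b) + a
    algebra = solve-∀
  #paths-split (suc m) w = begin
    #paths (2 + m) (2 + w)
      ≡⟨ cong₂ (λ x y → suc w * x + K * y) (#paths-split m w) (#paths-split m (suc w)) ⟩
    suc w * (A₁ + A₀) + K * (B₁ + B₀)
      ≡⟨ algebra w A₁ A₀ B₁ B₀ K ⟩
    #away (2 + m) 0 (2 + w) + #away (suc m) 0 (2 + w)
      ∎
    where
    open ≡-Reasoning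
    K  = k ∸ (2 + w)
    A₁ = #away (suc m) 0 (2 + w)
    A₀ = #away m 0 (2 + w)
    B₁ = #away (suc m) 0 (3 + w)
    B₀ = #away m 0 (3 + w)
    algebra : ∀ w a₁ a₀ b₁ b₀ K →
      suc w * (a₁ + a₀) + K * (b₁ + b₀) ≡ ((suc w * a₀ + K * b₀) + (w * a₁ + K * b₁)) + a₁
    algebra = solve-∀

  #home-recurrence : ∀ n → #home (2 + n) 0 1 ≡ #home n 0 1 + #home 2 n 1
  #home-recurrence zero    = refl
  #home-recurrence (suc j) = begin
    #home (3 + j) 0 1
      ≡⟨ algebra (k ∸ 1) (k ∸ 2) (#away j 0 2) (#away j 0 3) (#away (suc j) 0 3) ⟩
    (k ∸ 1) * #away j 0 2 + (k ∸ 1) * ((k ∸ 2) * (#away (suc j) 0 3 + #away j 0 3))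
      ≡⟨ cong (λ x → (k ∸ 1) * #away j 0 2 + (k ∸ 1) * ((k ∸ 2) * x)) (#paths-split j 1) ⟨
    #home (1 + j) 0 1 + #home 2 (1 + j) 1
      ∎
    where
    open ≡-Reasoning
    algebra : ∀ a b x y z → a * ((1 * x + b * y) + b * z) ≡ a * x + a * (b * (z + y))
    algebra = solve-∀

  P-exact-cycle-recurrence : ∀ n →
    P-exact (C (3 + n) ∪K₁ p) k ≡ P-exact (C (1 + n) ∪K₁ p) k + P-exact (Q (3 + n) ∪K₁ p) k
  P-exact-cycle-recurrence n = begin
    P-exact (C (3 + n) ∪K₁ p) k                               ≡⟨ P-exact-cycle (2 + n) ⟩
    k * #home (2 + n) 0 1                                     ≡⟨ cong (k *_) (#home-recurrence n) ⟩
    k * (#home n 0 1 + #home 2 n 1)                           ≡⟨ *-distribˡ-+ k _ _ ⟩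
    k * #home n 0 1 + k * #home 2 n 1                         ≡⟨ cong₂ _+_ (P-exact-cycle n) (P-exact-tadpole 2 n) ⟨
    P-exact (C (1 + n) ∪K₁ p) k + P-exact (Q (3 + n) ∪K₁ p) k ∎
    where open ≡-Reasoning

  #paths-∣ : ∀ m u → (k ∸ u) ! ∣ #paths m u
  #paths-∣ zero    u = #covers-∣ k p u
  #paths-∣ (suc m) u = !∣-step k u (∣n⇒∣m*n (u ∸ 1) (#paths-∣ m u)) (#paths-∣ m (suc u))

  #away-∣ : ∀ t m u → (k ∸ u) ! ∣ #away t m u
  #home-∣ : ∀ t m u → (k ∸ u) ! ∣ #home t m u
  #away-∣ zero    m u = #paths-∣ m u
  #away-∣ (suc t) m u =
    ∣m∣n⇒∣m+n (#home-∣ t m u) (!∣-step k u (∣n⇒∣m*n (u ∸ 2) (#away-∣ t m u)) (#away-∣ t m (suc u)))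
  #home-∣ zero    m u = _ ∣0
  #home-∣ (suc t) m u = !∣-step k u (∣n⇒∣m*n (u ∸ 1) (#away-∣ t m u)) (#away-∣ t m (suc u))

  k!∣P-exact-Q : ∀ m → k ! ∣ P-exact (Q (3 + m) ∪K₁ p) k
  k!∣P-exact-Q m = subst (k ! ∣_) (sym (P-exact-tadpole 2 m)) (pred!∣⇒!∣* k (#home-∣ 2 m 1))

  P-exact-cycle≡∑ : ∀ t → P-exact (C (2 * t + 3) ∪K₁ p) k ≡ sum (map (λ i → P-exact (Q (2 * i + 3) ∪K₁ p) k) (upTo (suc t)))
  P-exact-cycle≡∑ zero    = sym (+-identityʳ _)
  P-exact-cycle≡∑ (suc t) = begin
    Pᶜ (2 * suc t + 3)                       ≡⟨ cong Pᶜ (+-comm (2 * suc t) 3) ⟩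
    Pᶜ (3 + 2 * suc t)                       ≡⟨ P-exact-cycle-recurrence (2 * suc t) ⟩
    Pᶜ (1 + 2 * suc t) + Pᵠ (3 + 2 * suc t)  ≡⟨ cong₂ _+_ (cong Pᶜ (index t)) (cong Pᵠ (+-comm 3 (2 * suc t))) ⟩
    Pᶜ (2 * t + 3) + Pᵠ (2 * suc t + 3)      ≡⟨ cong (_+ Pᵠ (2 * suc t + 3)) (P-exact-cycle≡∑ t) ⟩
    sum (map g (upTo (suc t))) + g (suc t)   ≡⟨ sum-map-upTo-suc g (suc t) ⟨
    sum (map g (upTo (suc (suc t))))         ∎
    where
    open ≡-Reasoning
    Pᶜ Pᵠ g : ℕ → ℕ
    Pᶜ n = P-exact (C n ∪K₁ p) k
    Pᵠ n = P-exact (Q n ∪K₁ p) k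
    g i = Pᵠ (2 * i + 3)
    index : ∀ t → 1 + 2 * suc t ≡ 2 * t + 3
    index = solve-∀

  S-cycle≡∑ : ∀ t → S (C (2 * t + 3) ∪K₁ p) k ≡ sum (map (λ i → S (Q (2 * i + 3) ∪K₁ p) k) (upTo (suc t)))
  S-cycle≡∑ t = trans (cong (λ x → (x / k !) {{k !≢0}}) (P-exact-cycle≡∑ t))
    (sum-map-/ {{k !≢0}} (λ i → P-exact (Q (2 * i + 3) ∪K₁ p) k) (upTo (suc t))
      (λ i → subst (λ N → k ! ∣ P-exact (Q N ∪K₁ p) k) (+-comm 3 (2 * i)) (k!∣P-exact-Q (2 * i))))

odd⇒2t+3 : ∀ n → 3 ≤ n → n % 2 ≡ 1 → ∃[ t ] n ≡ 2 * t + 3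
odd⇒2t+3 1 (s≤s ()) _
odd⇒2t+3 3 _ _ = 0 , refl
odd⇒2t+3 4 _ ()
odd⇒2t+3 (suc (suc (suc (suc (suc n))))) _ odd with odd⇒2t+3 (3 + n) (s≤s (s≤s (s≤s z≤n))) odd
... | t , n≡ = suc t , trans (cong (2 +_) n≡) (shift t)
  where
  shift : ∀ t → 2 + (2 * t + 3) ≡ 2 * suc t + 3
  shift = solve-∀

[2t+3∸3]/2+1≡1+t : ∀ t → (2 * t + 3 ∸ 3) / 2 + 1 ≡ suc t
[2t+3∸3]/2+1≡1+t t = begin
  (2 * t + 3 ∸ 3) / 2 + 1 ≡⟨ cong (λ x → x / 2 + 1) (m+n∸n≡m (2 * t) 3) ⟩
  (2 * t) / 2 + 1         ≡⟨ cong (λ x → x / 2 + 1) (*-comm 2 t) ⟩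
  (t * 2) / 2 + 1         ≡⟨ cong (_+ 1) (m*n/n≡m t 2) ⟩
  t + 1                   ≡⟨ +-comm t 1 ⟩
  suc t                   ∎
  where open ≡-Reasoning

-- The identity holds for every k.
lemma22 : (n p k : ℕ) → 3 ≤ n → n % 2 ≡ 1 → 1 ≤ k → k ≤ n →
    S (C n ∪K₁ p) k ≡ sum (map (λ i → S (Q (2 * i + 3) ∪K₁ p) k) (upTo ((n ∸ 3) / 2 + 1)))
lemma22 n p k 3≤n odd _ _ with odd⇒2t+3 n 3≤n odd
... | t , refl = trans (S-cycle≡∑ k p t)
  (cong (λ j → sum (map (λ i → S (Q (2 * i + 3) ∪K₁ p) k) (upTo j))) (sym ([2t+3∸3]/2+1≡1+t t)))
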